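{- Let $n$ be a positive integer and let $p(n)$ denote the number of unrestricted partitions of $n$. Then $$p(n)=\sum_{m=1}^{n^2-1}|\mathbb{B}(m)|+1.$$
   Context: For a positive integer $m$, let $\mathbb{A}(m)$ be the set of all tuples $(c_1,\ldots,c_b)$ of non-negative integers with $c_1\ge c_2\ge\cdots\ge c_b\ge 0$ that solve the system $b=x_1+\cdots+x_b$, $a=x_1^2+\cdots+x_b^2$ for some pair of non-negative integers $(a,b)$ with $a\equiv b\pmod 2$ and $m=b^2+2a$. For the fixed $n$, $\mathbb{B}(m)$ is the subset of $\mathbb{A}(m)$ consisting of those solutions $(c_1,\ldots,c_b)$ with $b+c_1\le n$. -}

module Defs where

open import Data.Nat using (ℕ; zero; suc; _+_; _*_; _∸_; _%_; _≤_; _≥_; _<_)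
open import Data.List using (List; []; _∷_; length; map; applyUpTo)
open import Data.Nat.ListAction using (sum)
open import Data.List.Relation.Unary.Linked using (Linked)
open import Data.List.Relation.Unary.All using (All)
open import Data.Product using (Σ; _×_)
open import Relation.Binary.PropositionalEquality using (_≡_)

NonIncreasing : List ℕ → Set
NonIncreasing = Linked _≥_

-- first entry c₁ (0 for the empty tuple; irrelevant for m ≥ 1 since then b ≥ 1)
first : List ℕ → ℕ
first []      = 0
first (x ∷ _) = x

sumSq : List ℕ → ℕ
sumSq c = sum (map (λ x → x * x) c)

InA : ℕ → List ℕ → Set
InA m c = NonIncreasing c × Σ ℕ λ a → Σ ℕ λ b →
  (length c ≡ b) × (sum c ≡ b) × (sumSq c ≡ a) × (a % 2 ≡ b % 2) × (m ≡ b * b + 2 * a)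

𝔸 : ℕ → Set
𝔸 m = Σ (List ℕ) (InA m)

𝔹 : ℕ → ℕ → Set
𝔹 n m = Σ (List ℕ) λ c → InA m c × (length c + first c ≤ n)

Partition : ℕ → Set
Partition n = Σ (List ℕ) λ l → NonIncreasing l × All (0 <_) l × (sum l ≡ n)

sumFrom1 : ℕ → (ℕ → ℕ) → ℕ
sumFrom1 k f = sum (applyUpTo (λ i → f (suc i)) k)

module Submission where

-- Call a list c = (c₁,…,c_b) of naturals *balanced* if it is
-- non-increasing and its length b equals its sum, and *bounded by n* if
-- moreover b + c₁ ≤ n.  The argument has three parts.
--  (1) Partitions of n (n > 0) correspond bijectively to bounded balanced
--      tuples: drop the largest part λ₁ and pad the remaining parts with
--      zeros up to length n − λ₁ (their sum); conversely strip the zeros and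
--      put back the largest part n − b.
--  (2) For a balanced tuple the parity condition a ≡ b (mod 2) of 𝔸(m) holds
--      automatically (x² ≡ x mod 2), so 𝔹(m) is exactly the set of bounded
--      balanced tuples of weight b² + 2Σcᵢ² = m.  Since Σcᵢ² ≤ c₁b, every
--      bounded balanced tuple has weight < n², and only the empty one has
--      weight 0.
--  (3) Splitting a type along a bounded weight function into its fibres and
--      counting them (general facts about finite disjoint unions) gives
--      p(n) = 1 + Σ_{m=1}^{n²−1} |𝔹(m)|.

open import Defs
open import Data.Nat using (ℕ; _+_; _*_; _∸_; _<_)
open import Data.Fin using (Fin)
open import Function.Bundles using (_↔_)
open import Relation.Binary.PropositionalEquality using (_≡_)

open import Data.Nat using (zero; suc; _≤_; z≤n; s≤s; _%_)
open import Data.Nat.Properties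
open import Data.Nat.DivMod using (%-distribˡ-+; %-distribˡ-*; m%n<n)
open import Data.Nat.ListAction using (sum)
open import Data.Nat.ListAction.Properties using (sum-++)
open import Data.Nat.Solver using (module +-*-Solver)
open import Data.List using (List; []; _∷_; length; applyUpTo; _++_; replicate)
open import Data.List.Properties using (length-++; length-replicate)
open import Data.List.Relation.Unary.Linked as Linked using ([]; [-]; _∷_)
open import Data.List.Relation.Unary.All as All using (All; []; _∷_)
open import Data.Product using (Σ; _×_; _,_; proj₁)
open import Data.Sum using (_⊎_; inj₁; inj₂)
open import Data.Unit using (⊤; tt)
open import Data.Empty using (⊥; ⊥-elim)
open import Relation.Nullary.Irrelevant using (Irrelevant)
open import Relation.Binary.PropositionalEquality using (refl; sym; trans; cong; cong₂; subst; module ≡-Reasoning)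
open import Function.Bundles using (mk↔ₛ′)
open import Function.Properties.Inverse using (↔-refl; ↔-sym; ↔-trans)
open import Function.Related.Propositional using (module EquationalReasoning)
open import Function.Related.TypeIsomorphisms using (Σ-assoc)
open import Data.Sum.Function.Propositional using (_⊎-↔_)
open import Data.Fin.Properties using (+↔⊎; 0↔⊥; 1↔⊤)
open import Data.Fin.Permutation using (↔⇒≡)

-- Subtypes and finite disjoint unions

subtype-≡ : ∀ {C : Set} {R : C → Set} → (∀ {z} → Irrelevant (R z)) →
  ∀ {z z'} {r : R z} {r' : R z'} → z ≡ z' → _≡_ {A = Σ C R} (z , r) (z' , r')
subtype-≡ irr {r = r} {r'} refl = cong (_ ,_) (irr r r')

subtype-↔ : ∀ {A B : Set} {P : A → Set} {Q : B → Set} →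
  (∀ {x} → Irrelevant (P x)) → (∀ {y} → Irrelevant (Q y)) →
  (f : A → B) (g : B → A) →
  (∀ {x} → P x → Q (f x)) → (∀ {y} → Q y → P (g y)) →
  (∀ {x} → P x → g (f x) ≡ x) → (∀ {y} → Q y → f (g y) ≡ y) →
  Σ A P ↔ Σ B Q
subtype-↔ irrP irrQ f g f-pres g-pres gf≡id fg≡id =
  mk↔ₛ′ (λ (x , p) → f x , f-pres p) (λ (y , q) → g y , g-pres q)
        (λ (y , q) → subtype-≡ irrQ (fg≡id q)) (λ (x , p) → subtype-≡ irrP (gf≡id p))

Below : ℕ → (ℕ → Set) → Set
Below k F = Σ ℕ λ i → i < k × F i

below-zero : (F : ℕ → Set) → Below 0 F ↔ ⊥
below-zero F = mk↔ₛ′ (λ { (_ , () , _) }) (λ ()) (λ ()) (λ { (_ , () , _) })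

below-suc : ∀ k (F : ℕ → Set) → Below (suc k) F ↔ (F 0 ⊎ Below k (λ i → F (suc i)))
below-suc k F = mk↔ₛ′ to from to∘from from∘to
  where
  to : Below (suc k) F → F 0 ⊎ Below k (λ i → F (suc i))
  to (zero , _ , x) = inj₁ x
  to (suc i , s≤s i<k , x) = inj₂ (i , i<k , x)

  from : F 0 ⊎ Below k (λ i → F (suc i)) → Below (suc k) F
  from (inj₁ x) = zero , s≤s z≤n , x
  from (inj₂ (i , i<k , x)) = suc i , s≤s i<k , x

  to∘from : ∀ y → to (from y) ≡ y
  to∘from (inj₁ _) = refl
  to∘from (inj₂ _) = refl

  from∘to : ∀ x → from (to x) ≡ x
  from∘to (zero , s≤s z≤n , _) = refl
  from∘to (suc _ , s≤s _ , _) = refl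

below-card : ∀ k (F : ℕ → Set) (f : ℕ → ℕ) → (∀ i → F i ↔ Fin (f i)) →
  Below k F ↔ Fin (sum (applyUpTo f k))
below-card zero F f card = begin
  Below 0 F ↔⟨ below-zero F ⟩
  ⊥         ↔⟨ ↔-sym 0↔⊥ ⟩
  Fin 0     ∎
  where open EquationalReasoning
below-card (suc k) F f card = begin
  Below (suc k) F                         ↔⟨ below-suc k F ⟩
  (F 0 ⊎ Below k (λ i → F (suc i)))       ↔⟨ card 0 ⊎-↔ below-card k _ _ (λ i → card (suc i)) ⟩
  (Fin (f 0) ⊎ Fin (sum (applyUpTo (λ i → f (suc i)) k))) ↔⟨ ↔-sym +↔⊎ ⟩
  Fin (sum (applyUpTo f (suc k)))         ∎
  where open EquationalReasoning

Fibre : {X : Set} → (X → ℕ) → ℕ → Set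
Fibre {X} w m = Σ X λ x → w x ≡ m

fibres : ∀ {X : Set} (w : X → ℕ) {N} → (∀ x → w x < N) → X ↔ Below N (Fibre w)
fibres {X} w {N} bound = mk↔ₛ′ to from to∘from (λ _ → refl)
  where
  to : X → Below N (Fibre w)
  to x = w x , bound x , x , refl

  from : Below N (Fibre w) → X
  from (_ , _ , x , _) = x

  to∘from : ∀ y → to (from y) ≡ y
  to∘from (_ , w<N , x , refl) = cong (λ p → w x , p , x , refl) (<-irrelevant (bound x) w<N)

-- Non-increasing lists: positive prefix and trailing zeros

positives : List ℕ → List ℕ
positives []           = []
positives (zero ∷ _)   = []
positives (suc x ∷ xs) = suc x ∷ positives xs

zeroCount : List ℕ → ℕ
zeroCount []           = 0
zeroCount (zero ∷ xs)  = suc (length xs)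
zeroCount (suc _ ∷ xs) = zeroCount xs

padZeros : List ℕ → ℕ → List ℕ
padZeros r z = r ++ replicate z 0

after-zero : ∀ {xs} → NonIncreasing (0 ∷ xs) → xs ≡ replicate (length xs) 0
after-zero {[]}     _         = refl
after-zero {_ ∷ _} (z≤n ∷ ni) = cong (0 ∷_) (after-zero ni)

positives-split : ∀ {c} → NonIncreasing c → padZeros (positives c) (zeroCount c) ≡ c
positives-split {[]}         _  = refl
positives-split {zero ∷ _}   ni = cong (0 ∷_) (sym (after-zero ni))
positives-split {suc x ∷ _}  ni = cong (suc x ∷_) (positives-split (Linked.tail ni))

positives-positive : ∀ c → All (0 <_) (positives c)
positives-positive []           = []
positives-positive (zero ∷ _)   = []
positives-positive (suc _ ∷ xs) = s≤s z≤n ∷ positives-positive xs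

head-bounds-next : ∀ {x xs} → NonIncreasing (x ∷ xs) → first xs ≤ x
head-bounds-next [-]      = z≤n
head-bounds-next (x≥y ∷ _) = x≥y

cons-nonIncreasing : ∀ {x ys} → first ys ≤ x → NonIncreasing ys → NonIncreasing (x ∷ ys)
cons-nonIncreasing {ys = []}    _   _  = [-]
cons-nonIncreasing {ys = _ ∷ _} y≤x ni = y≤x ∷ ni

first-positives : ∀ c → first (positives c) ≤ first c
first-positives []           = z≤n
first-positives (zero ∷ _)   = z≤n
first-positives (suc _ ∷ _)  = ≤-refl

positives-nonIncreasing : ∀ {c} → NonIncreasing c → NonIncreasing (positives c)
positives-nonIncreasing {[]}         _  = []
positives-nonIncreasing {zero ∷ _}   _  = []
positives-nonIncreasing {suc _ ∷ xs} ni =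
  cons-nonIncreasing (≤-trans (first-positives xs) (head-bounds-next ni))
                     (positives-nonIncreasing (Linked.tail ni))

positives-padZeros : ∀ {r} → All (0 <_) r → ∀ z → positives (padZeros r z) ≡ r
positives-padZeros []               zero    = refl
positives-padZeros []               (suc _) = refl
positives-padZeros (s≤s _ ∷ r>0)    z       = cong (_ ∷_) (positives-padZeros r>0 z)

zeros-nonIncreasing : ∀ z → NonIncreasing (replicate z 0)
zeros-nonIncreasing zero          = []
zeros-nonIncreasing (suc zero)    = [-]
zeros-nonIncreasing (suc (suc z)) = z≤n ∷ zeros-nonIncreasing (suc z)

padZeros-nonIncreasing : ∀ {r} → NonIncreasing r → ∀ z → NonIncreasing (padZeros r z)
padZeros-nonIncreasing []         z       = zeros-nonIncreasing z
padZeros-nonIncreasing [-]        zero    = [-]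
padZeros-nonIncreasing [-]        (suc z) = z≤n ∷ zeros-nonIncreasing (suc z)
padZeros-nonIncreasing (x≥y ∷ ni) z       = x≥y ∷ padZeros-nonIncreasing ni z

sum-zeros : ∀ z → sum (replicate z 0) ≡ 0
sum-zeros zero    = refl
sum-zeros (suc z) = sum-zeros z

sum-padZeros : ∀ r z → sum (padZeros r z) ≡ sum r
sum-padZeros r z = begin
  sum (r ++ replicate z 0)         ≡⟨ sum-++ r (replicate z 0) ⟩
  sum r + sum (replicate z 0)      ≡⟨ cong (sum r +_) (sum-zeros z) ⟩
  sum r + 0                        ≡⟨ +-identityʳ (sum r) ⟩
  sum r                            ∎
  where open ≡-Reasoning

length-padZeros : ∀ r z → length (padZeros r z) ≡ length r + z
length-padZeros r z = trans (length-++ r) (cong (length r +_) (length-replicate z))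

first-padZeros : ∀ r z → first (padZeros r z) ≡ first r
first-padZeros []      zero    = refl
first-padZeros []      (suc _) = refl
first-padZeros (_ ∷ _) _       = refl

sum-positives : ∀ {c} → NonIncreasing c → sum (positives c) ≡ sum c
sum-positives {c} ni = begin
  sum (positives c)                           ≡⟨ sym (sum-padZeros (positives c) (zeroCount c)) ⟩
  sum (padZeros (positives c) (zeroCount c))  ≡⟨ cong sum (positives-split ni) ⟩
  sum c                                       ∎
  where open ≡-Reasoning

length≤sum : ∀ {r} → All (0 <_) r → length r ≤ sum r
length≤sum []          = z≤n
length≤sum (x>0 ∷ r>0) = +-mono-≤ x>0 (length≤sum r>0)

-- Balanced tuples and partitions

IsBalanced : ℕ → List ℕ → Set
IsBalanced n c = NonIncreasing c × length c ≡ sum c × length c + first c ≤ n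

Balanced : ℕ → Set
Balanced n = Σ (List ℕ) (IsBalanced n)

nonIncreasing-irrelevant : ∀ {c} → Irrelevant (NonIncreasing c)
nonIncreasing-irrelevant = Linked.irrelevant ≤-irrelevant

isBalanced-irrelevant : ∀ {n c} → Irrelevant (IsBalanced n c)
isBalanced-irrelevant (ni , e , bnd) (ni' , e' , bnd') =
  cong₂ _,_ (nonIncreasing-irrelevant ni ni') (cong₂ _,_ (≡-irrelevant e e') (≤-irrelevant bnd bnd'))

IsPartition : ℕ → List ℕ → Set
IsPartition n l = NonIncreasing l × All (0 <_) l × sum l ≡ n

isPartition-irrelevant : ∀ {n l} → Irrelevant (IsPartition n l)
isPartition-irrelevant (ni , pos , s) (ni' , pos' , s') =
  cong₂ _,_ (nonIncreasing-irrelevant ni ni') (cong₂ _,_ (All.irrelevant ≤-irrelevant pos pos') (≡-irrelevant s s'))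

-- A nonempty balanced tuple has a positive first entry: otherwise all its
-- entries vanish and its sum 0 would equal its positive length.
balanced-head-positive : ∀ {x xs} → NonIncreasing (x ∷ xs) → length (x ∷ xs) ≡ sum (x ∷ xs) → 0 < x
balanced-head-positive {zero}  ni e with trans e (sym (sum-positives ni))
... | ()
balanced-head-positive {suc _} _  _ = s≤s z≤n

balanced-length< : ∀ {n c} → 0 < n → IsBalanced n c → length c < n
balanced-length< {c = []}     n>0 _              = n>0
balanced-length< {c = x ∷ xs} _   (ni , e , bnd) =
  <-≤-trans (m<m+n (length (x ∷ xs)) (balanced-head-positive ni e)) bnd

balance : List ℕ → List ℕ
balance r = padZeros r (sum r ∸ length r)

length-balance : ∀ {r} → All (0 <_) r → length (balance r) ≡ sum r
length-balance {r} r>0 = trans (length-padZeros r _) (m+[n∸m]≡n (length≤sum r>0))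

balance-positives : ∀ {c} → NonIncreasing c → length c ≡ sum c → balance (positives c) ≡ c
balance-positives {c} ni e = trans (cong (padZeros s) missing≡zeros) (positives-split ni)
  where
  s = positives c
  missing≡zeros : sum s ∸ length s ≡ zeroCount c
  missing≡zeros = begin
    sum s ∸ length s                                  ≡⟨ cong (_∸ length s) (sum-positives ni) ⟩
    sum c ∸ length s                                  ≡⟨ cong (_∸ length s) (sym e) ⟩
    length c ∸ length s                               ≡⟨ cong (λ l → length l ∸ length s) (sym (positives-split ni)) ⟩
    length (padZeros s (zeroCount c)) ∸ length s      ≡⟨ cong (_∸ length s) (length-padZeros s (zeroCount c)) ⟩
    length s + zeroCount c ∸ length s                 ≡⟨ m+n∸m≡n (length s) (zeroCount c) ⟩
    zeroCount c                                       ∎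
    where open ≡-Reasoning

dropLargest : List ℕ → List ℕ
dropLargest []      = []
dropLargest (_ ∷ r) = balance r

restoreLargest : ℕ → List ℕ → List ℕ
restoreLargest n c = (n ∸ length c) ∷ positives c

dropLargest-balanced : ∀ {n l} → IsPartition n l → IsBalanced n (dropLargest l)
dropLargest-balanced {l = []}    _                           = [] , refl , z≤n
dropLargest-balanced {n} {k ∷ r} (ni , _ ∷ r>0 , k+Σr≡n) =
  padZeros-nonIncreasing (Linked.tail ni) _ ,
  trans (length-balance r>0) (sym (sum-padZeros r _)) ,
  bounded
  where
  bounded : length (balance r) + first (balance r) ≤ n
  bounded = begin
    length (balance r) + first (balance r)  ≡⟨ cong₂ _+_ (length-balance r>0) (first-padZeros r _) ⟩
    sum r + first r                         ≤⟨ +-monoʳ-≤ (sum r) (head-bounds-next ni) ⟩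
    sum r + k                               ≡⟨ trans (+-comm (sum r) k) k+Σr≡n ⟩
    n                                       ∎
    where open ≤-Reasoning

restoreLargest-partition : ∀ {n c} → 0 < n → IsBalanced n c → IsPartition n (restoreLargest n c)
restoreLargest-partition {n} {c} n>0 bal@(ni , e , bnd) =
  cons-nonIncreasing (≤-trans (first-positives c) c₁≤n∸b) (positives-nonIncreasing ni) ,
  m<n⇒0<n∸m b<n ∷ positives-positive c ,
  sums-to-n
  where
  b<n : length c < n
  b<n = balanced-length< n>0 bal

  c₁≤n∸b : first c ≤ n ∸ length c
  c₁≤n∸b = begin
    first c                           ≡⟨ sym (m+n∸m≡n (length c) (first c)) ⟩
    length c + first c ∸ length c     ≤⟨ ∸-monoˡ-≤ (length c) bnd ⟩
    n ∸ length c                      ∎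
    where open ≤-Reasoning

  sums-to-n : (n ∸ length c) + sum (positives c) ≡ n
  sums-to-n = begin
    (n ∸ length c) + sum (positives c)  ≡⟨ cong ((n ∸ length c) +_) (trans (sum-positives ni) (sym e)) ⟩
    (n ∸ length c) + length c           ≡⟨ m∸n+n≡m (<⇒≤ b<n) ⟩
    n                                   ∎
    where open ≡-Reasoning

restore∘drop : ∀ {n l} → 0 < n → IsPartition n l → restoreLargest n (dropLargest l) ≡ l
restore∘drop {l = []}    n>0 (_ , _ , refl) = ⊥-elim (<-irrefl refl n>0)
restore∘drop {n} {k ∷ r} _   (_ , _ ∷ r>0 , k+Σr≡n) = cong₂ _∷_ largest (positives-padZeros r>0 _)
  where
  largest : n ∸ length (balance r) ≡ k
  largest = trans (cong₂ _∸_ (sym k+Σr≡n) (length-balance r>0)) (m+n∸n≡m k (sum r))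

drop∘restore : ∀ {n c} → IsBalanced n c → dropLargest (restoreLargest n c) ≡ c
drop∘restore (ni , e , _) = balance-positives ni e

partition↔balanced : ∀ {n} → 0 < n → Partition n ↔ Balanced n
partition↔balanced {n} n>0 =
  subtype-↔ isPartition-irrelevant isBalanced-irrelevant
    dropLargest (restoreLargest n)
    dropLargest-balanced (restoreLargest-partition n>0)
    (restore∘drop n>0) drop∘restore

-- Weights

-- The weight b² + 2·Σcᵢ² of a tuple; its fibres will be the sets 𝔹(m).
weight : List ℕ → ℕ
weight c = length c * length c + 2 * sumSq c

square-parity : ∀ x → (x * x) % 2 ≡ x % 2
square-parity x = trans (%-distribˡ-* x x 2) (bit-square (x % 2) (m%n<n x 2))
  where
  bit-square : ∀ r → r < 2 → (r * r) % 2 ≡ r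
  bit-square 0 _ = refl
  bit-square 1 _ = refl
  bit-square (suc (suc _)) (s≤s (s≤s ()))

-- Hence Σcᵢ² ≡ Σcᵢ (mod 2): the parity condition in 𝔸(m) is automatic.
sumSq-parity : ∀ c → sumSq c % 2 ≡ sum c % 2
sumSq-parity []       = refl
sumSq-parity (x ∷ xs) = begin
  (x * x + sumSq xs) % 2                 ≡⟨ %-distribˡ-+ (x * x) (sumSq xs) 2 ⟩
  ((x * x) % 2 + sumSq xs % 2) % 2       ≡⟨ cong₂ (λ u v → (u + v) % 2) (square-parity x) (sumSq-parity xs) ⟩
  (x % 2 + sum xs % 2) % 2               ≡⟨ sym (%-distribˡ-+ x (sum xs) 2) ⟩
  (x + sum xs) % 2                       ∎
  where open ≡-Reasoning

sumSq≤ : ∀ {c} → NonIncreasing c → sumSq c ≤ first c * sum c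
sumSq≤ {[]}     _  = z≤n
sumSq≤ {x ∷ xs} ni = begin
  x * x + sumSq xs         ≤⟨ +-monoʳ-≤ (x * x) (sumSq≤ (Linked.tail ni)) ⟩
  x * x + first xs * sum xs ≤⟨ +-monoʳ-≤ (x * x) (*-monoˡ-≤ (sum xs) (head-bounds-next ni)) ⟩
  x * x + x * sum xs       ≡⟨ sym (*-distribˡ-+ x x (sum xs)) ⟩
  x * (x + sum xs)         ∎
  where open ≤-Reasoning

square-gap : ∀ b c → 0 < c → b * b + 2 * (c * b) < (b + c) * (b + c)
square-gap b c c>0 = begin-strict
  b * b + 2 * (c * b)             <⟨ m<m+n (b * b + 2 * (c * b)) (*-mono-< c>0 c>0) ⟩
  b * b + 2 * (c * b) + c * c     ≡⟨ binomial b c ⟩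
  (b + c) * (b + c)               ∎
  where
  open ≤-Reasoning
  open +-*-Solver using (solve; _:+_; _:*_; _:=_; con)
  binomial : ∀ b c → b * b + 2 * (c * b) + c * c ≡ (b + c) * (b + c)
  binomial = solve 2 (λ b c → b :* b :+ con 2 :* (c :* b) :+ c :* c := (b :+ c) :* (b :+ c)) refl

weight-bound : ∀ {n c} → 0 < n → IsBalanced n c → weight c < n * n
weight-bound {c = []}     n>0 _              = *-mono-< n>0 n>0
weight-bound {n} {c = x ∷ xs} _ (ni , e , bnd) = begin-strict
  b * b + 2 * sumSq c        ≤⟨ +-monoʳ-≤ (b * b) (*-monoʳ-≤ 2 sumSq≤xb) ⟩
  b * b + 2 * (x * b)        <⟨ square-gap b x (balanced-head-positive ni e) ⟩
  (b + x) * (b + x)          ≤⟨ *-mono-≤ bnd bnd ⟩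
  n * n                      ∎
  where
  open ≤-Reasoning
  c = x ∷ xs
  b = length c
  sumSq≤xb : sumSq c ≤ x * b
  sumSq≤xb = ≤-trans (sumSq≤ ni) (≤-reflexive (cong (x *_) (sym e)))

-- The sets 𝔹(m) as weight fibres

WeightFibre : ℕ → ℕ → Set
WeightFibre n = Fibre {Balanced n} (λ x → weight (proj₁ x))

-- Membership in 𝔸(m) is a proposition: a and b are determined by c.
inA-irrelevant : ∀ {m c} → Irrelevant (InA m c)
inA-irrelevant (ni , a , b , refl , Σ≡b , refl , par , m≡) (ni' , _ , _ , refl , Σ≡b' , refl , par' , m≡') =
  cong₂ (λ u v → u , a , b , refl , v) (nonIncreasing-irrelevant ni ni')
        (cong₂ (λ u v → u , refl , v) (≡-irrelevant Σ≡b Σ≡b')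
               (cong₂ _,_ (≡-irrelevant par par') (≡-irrelevant m≡ m≡')))

-- A bounded balanced tuple of weight m lies in 𝔹(m) (with a = Σcᵢ², b = length c) …
balanced⇒𝔹 : ∀ {n m c} → IsBalanced n c × weight c ≡ m → InA m c × length c + first c ≤ n
balanced⇒𝔹 {c = c} ((ni , e , bnd) , weight≡m) =
  (ni , sumSq c , length c , refl , sym e , refl , parity , sym weight≡m) , bnd
  where
  parity : sumSq c % 2 ≡ length c % 2
  parity = trans (sumSq-parity c) (cong (_% 2) (sym e))

𝔹⇒balanced : ∀ {n m c} → InA m c × length c + first c ≤ n → IsBalanced n c × weight c ≡ m
𝔹⇒balanced ((ni , _ , _ , refl , Σ≡b , refl , _ , m≡) , bnd) = (ni , sym Σ≡b , bnd) , sym m≡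

fibre↔𝔹 : ∀ n m → WeightFibre n m ↔ 𝔹 n m
fibre↔𝔹 n m = begin
  WeightFibre n m                                    ↔⟨ Σ-assoc ⟩
  Σ (List ℕ) (λ c → IsBalanced n c × weight c ≡ m)   ↔⟨ same-subtype ⟩
  𝔹 n m                                              ∎
  where
  open EquationalReasoning
  balanced-irrelevant : ∀ {c} → Irrelevant (IsBalanced n c × weight c ≡ m)
  balanced-irrelevant (p , q) (p' , q') = cong₂ _,_ (isBalanced-irrelevant p p') (≡-irrelevant q q')
  𝔹-irrelevant : ∀ {c} → Irrelevant (InA m c × length c + first c ≤ n)
  𝔹-irrelevant (p , q) (p' , q') = cong₂ _,_ (inA-irrelevant p p') (≤-irrelevant q q')
  same-subtype : Σ (List ℕ) (λ c → IsBalanced n c × weight c ≡ m) ↔ 𝔹 n m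
  same-subtype = subtype-↔ balanced-irrelevant 𝔹-irrelevant (λ c → c) (λ c → c)
                   balanced⇒𝔹 𝔹⇒balanced (λ _ → refl) (λ _ → refl)

fibre-zero : ∀ n → WeightFibre n 0 ↔ ⊤
fibre-zero n = mk↔ₛ′ (λ _ → tt) (λ _ → empty) (λ _ → refl) empty-unique
  where
  empty : WeightFibre n 0
  empty = ([] , [] , refl , z≤n) , refl
  empty-unique : ∀ x → empty ≡ x
  empty-unique (([] , bal) , refl) = cong (λ p → ([] , p) , refl) (isBalanced-irrelevant _ bal)
  empty-unique ((_ ∷ _ , _) , ())

mainTheorem9 : (n : ℕ) → 0 < n →
    (p : ℕ) → Partition n ↔ Fin p →
    (B : ℕ → ℕ) → (∀ m → 𝔹 n m ↔ Fin (B m)) →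
    p ≡ sumFrom1 (n * n ∸ 1) B + 1
mainTheorem9 n n>0 p partitions B 𝔹-card = trans (↔⇒≡ counting) (+-comm 1 (sumFrom1 K B))
  where
  open EquationalReasoning
  K = n * n ∸ 1

  1+K≡n² : suc K ≡ n * n
  1+K≡n² = m+[n∸m]≡n (*-mono-≤ n>0 n>0)

  weight<1+K : ∀ x → weight (proj₁ x) < suc K
  weight<1+K (c , bal) = subst (weight c <_) (sym 1+K≡n²) (weight-bound n>0 bal)

  fibre-card : ∀ i → WeightFibre n (suc i) ↔ Fin (B (suc i))
  fibre-card i = ↔-trans (fibre↔𝔹 n (suc i)) (𝔹-card (suc i))

  counting : Fin p ↔ Fin (1 + sumFrom1 K B)
  counting = begin
    Fin p                                                       ↔⟨ ↔-sym partitions ⟩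
    Partition n                                                 ↔⟨ partition↔balanced n>0 ⟩
    Balanced n                                                  ↔⟨ fibres _ weight<1+K ⟩
    Below (suc K) (WeightFibre n)                               ↔⟨ below-suc K (WeightFibre n) ⟩
    (WeightFibre n 0 ⊎ Below K (λ i → WeightFibre n (suc i)))  ↔⟨ fibre-zero n ⊎-↔ below-card K _ _ fibre-card ⟩
    (⊤ ⊎ Fin (sumFrom1 K B))                                    ↔⟨ ↔-sym 1↔⊤ ⊎-↔ ↔-refl ⟩
    (Fin 1 ⊎ Fin (sumFrom1 K B))                                ↔⟨ ↔-sym +↔⊎ ⟩
    Fin (1 + sumFrom1 K B)                                      ∎
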